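{- If $a_3\geq 6$ and $a_3\equiv 0\bmod 6$, then the triple $(2,3,a_3)$ is perfect.
   Context: For a graph $G$, the $3$-neighbour bootstrap process starts from a set $A_0\subseteq V(G)$ and, for $t\ge1$, sets $A_t=A_{t-1}\cup\{v: |N_G(v)\cap A_{t-1}|\ge 3\}$; $A_0$ percolates if $\bigcup_t A_t=V(G)$. For positive integers $a_1,a_2,a_3$, $[a_1]\times[a_2]\times[a_3]$ denotes the grid graph (vertices adjacent iff they differ by exactly 1 in exactly one coordinate), and $m(a_1,a_2,a_3;3)$ is the minimum size of a percolating set for the $3$-neighbour process in it. A triple $(a_1,a_2,a_3)$ of positive integers is called perfect if $a_1a_2+a_1a_3+a_2a_3\equiv 0\pmod 3$ and $m(a_1,a_2,a_3;3)=\frac{a_1a_2+a_1a_3+a_2a_3}{3}$. -}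

module Defs where

open import Data.Nat using (ℕ; zero; suc; _+_; _*_; _≤_; ∣_-_∣; _≡ᵇ_)
open import Data.Nat.DivMod using (_%_; _/_)
open import Data.Fin using (Fin; toℕ)
open import Data.Bool using (Bool; true; false; _∧_; _∨_; if_then_else_)
open import Data.List using (List; []; _∷_; length; filter; concatMap; map; allFin)
open import Data.Product using (_×_; _,_; ∃)
open import Relation.Binary.PropositionalEquality using (_≡_)
open import Relation.Nullary.Decidable using (⌊_⌋)
open import Data.Bool.Properties using () renaming (_≟_ to _≟ᵇ_)

Vertex : ℕ → ℕ → ℕ → Set
Vertex a₁ a₂ a₃ = Fin a₁ × Fin a₂ × Fin a₃

-- all vertices, as a list without repetitions
vertices : (a₁ a₂ a₃ : ℕ) → List (Vertex a₁ a₂ a₃)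
vertices a₁ a₂ a₃ =
  concatMap (λ i → concatMap (λ j → map (λ k → (i , j , k)) (allFin a₃)) (allFin a₂)) (allFin a₁)

VSet : ℕ → ℕ → ℕ → Set
VSet a₁ a₂ a₃ = Vertex a₁ a₂ a₃ → Bool

countB : {A : Set} → (A → Bool) → List A → ℕ
countB p [] = 0
countB p (x ∷ xs) = (if p x then 1 else 0) + countB p xs

size : {a₁ a₂ a₃ : ℕ} → VSet a₁ a₂ a₃ → ℕ
size {a₁} {a₂} {a₃} A = countB A (vertices a₁ a₂ a₃)

eqF : {n : ℕ} → Fin n → Fin n → Bool
eqF x y = toℕ x ≡ᵇ toℕ y

dist1 : {n : ℕ} → Fin n → Fin n → Bool
dist1 x y = ∣ toℕ x - toℕ y ∣ ≡ᵇ 1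

adj : {a₁ a₂ a₃ : ℕ} → Vertex a₁ a₂ a₃ → Vertex a₁ a₂ a₃ → Bool
adj (x₁ , x₂ , x₃) (y₁ , y₂ , y₃) =
     (dist1 x₁ y₁ ∧ eqF x₂ y₂ ∧ eqF x₃ y₃)
  ∨ (eqF x₁ y₁ ∧ dist1 x₂ y₂ ∧ eqF x₃ y₃)
  ∨ (eqF x₁ y₁ ∧ eqF x₂ y₂ ∧ dist1 x₃ y₃)

nbrsIn : {a₁ a₂ a₃ : ℕ} → VSet a₁ a₂ a₃ → Vertex a₁ a₂ a₃ → ℕ
nbrsIn {a₁} {a₂} {a₃} A v = countB (λ w → adj v w ∧ A w) (vertices a₁ a₂ a₃)

step : {a₁ a₂ a₃ : ℕ} → VSet a₁ a₂ a₃ → VSet a₁ a₂ a₃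
step A v = A v ∨ (3 Data.Nat.≤ᵇ nbrsIn A v)

stage : {a₁ a₂ a₃ : ℕ} → VSet a₁ a₂ a₃ → ℕ → VSet a₁ a₂ a₃
stage A zero = A
stage A (suc t) = step (stage A t)

Percolates : {a₁ a₂ a₃ : ℕ} → VSet a₁ a₂ a₃ → Set
Percolates A = ∀ v → ∃ λ t → stage A t v ≡ true

σ : ℕ → ℕ → ℕ → ℕ
σ a₁ a₂ a₃ = a₁ * a₂ + a₁ * a₃ + a₂ * a₃

-- m(a₁,a₂,a₃;3) = σ/3, expressed as: some percolating set of size σ/3 exists,
-- and every percolating set has size ≥ σ/3.
Perfect : ℕ → ℕ → ℕ → Set
Perfect a₁ a₂ a₃ =
  (σ a₁ a₂ a₃ % 3 ≡ 0)
  × (∃ λ (A : VSet a₁ a₂ a₃) → Percolates A × size A ≡ σ a₁ a₂ a₃ / 3)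
  × (∀ (A : VSet a₁ a₂ a₃) → Percolates A → σ a₁ a₂ a₃ / 3 ≤ size A)

{-# OPTIONS --safe #-}
-- Lower bound, in every grid: a vertex infected through three infected neighbours adds at
-- least six ordered adjacent pairs inside the infected set, so the perimeter
-- 6 |B| - #{ordered adjacent pairs inside B} never increases along the process.  A percolating
-- set A therefore satisfies 6 |V| ≤ 6 |A| + 2 |E|, and 2 |E| = 6 a₁ a₂ a₃ - 2 σ gives |A| ≥ σ / 3.
--
-- Upper bound for [2] × [3] × [6q]: the seeds are a motif of ten vertices repeated in each block
-- of six layers, plus (1, 1, 0) and the top vertex (1, 2, 6q - 1) of the column (1, 2), in total
-- 10 q + 2 = σ / 3.  Infection is local, so it is certified by explicit infection sequences inside
-- windows of a few consecutive layers, checked by evaluation.  Going up, a window of eight layers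
-- carries a layer that is infected outside the column (1, 2) six layers higher; the last block then
-- fills completely, and the column (1, 2) is infected downwards one layer at a time.

module Submission where

open import Defs
open import Data.Nat using (_≤?_; ℕ; zero; suc; NonZero; z<s; s<s; _+_; _*_; _∸_; _≤_; _<_; z≤n; s≤s; _≡ᵇ_; _≤ᵇ_; ∣_-_∣)
open import Data.Nat.Properties
open import Data.Nat.DivMod using (_/_; _%_; m/n*n≤m; m<n⇒m%n≡m; [m+n]%n≡m%n; [m+kn]%n≡m%n; m*n%n≡0; m*n/n≡m; m≡m%n+[m/n]*n)
open import Data.Nat.Tactic.RingSolver using (solve-∀)
open import Data.Fin as Fin using (Fin; toℕ; #_) renaming (zero to fzero; suc to fsuc)
open import Data.Fin.Properties as Fin using (toℕ-injective; toℕ-fromℕ<; toℕ-inject≤; toℕ-↑ʳ)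
open import Data.Bool using (Bool; true; false; _∧_; _∨_; not; if_then_else_; T)
open import Data.Bool.Properties using (∧-comm; ∨-zeroʳ)
open import Data.List using (List; []; _∷_; _++_; map; concatMap; tabulate; allFin)
open import Data.Product using (_×_; _,_; ∃; proj₁; proj₂)
open import Data.Product.Properties using (≡-dec)
open import Function using (_∘_; _∘₂_)
open import Relation.Nullary using (Dec; yes; no; does; ¬?; contradiction)
open import Relation.Nullary.Decidable using (⌊_⌋; dec-true; toWitness; T?; _×-dec_; _→-dec_)
open import Relation.Binary.Definitions using (DecidableEquality)
open import Relation.Binary.PropositionalEquality
open import Algebra.Properties.CommutativeSemigroup +-commutativeSemigroup using (interchange)

-- Indicators and finite sums

χ : Bool → ℕ
χ b = if b then 1 else 0

χ≤1 : (b : Bool) → χ b ≤ 1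
χ≤1 true = ≤-refl
χ≤1 false = z≤n

χ-∧ : (b c : Bool) → χ (b ∧ c) ≡ χ b * χ c
χ-∧ true c = sym (+-identityʳ (χ c))
χ-∧ false c = refl

χ-∨ : (b c : Bool) → χ (b ∨ c) ≤ χ b + χ c
χ-∨ true c = s≤s z≤n
χ-∨ false c = ≤-refl

χ-∨-disjoint : (b c : Bool) → χ (b ∨ c) ≡ χ b + χ (not b ∧ c)
χ-∨-disjoint true c = refl
χ-∨-disjoint false c = refl

T⇒≡true : {b : Bool} → T b → b ≡ true
T⇒≡true {true} _ = refl

≡true⇒T : {b : Bool} → b ≡ true → T b
≡true⇒T refl = _

∧-intro : {b c : Bool} → T b → T c → T (b ∧ c)
∧-intro {true} _ t = t

∧-elim : {b c : Bool} → T (b ∧ c) → T b × T c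
∧-elim {true} t = _ , t

∨-introˡ : {b : Bool} (c : Bool) → T b → T (b ∨ c)
∨-introˡ {true} _ _ = _

∨-introʳ : (b : Bool) {c : Bool} → T c → T (b ∨ c)
∨-introʳ true _ = _
∨-introʳ false t = t

∑ : {A : Set} → List A → (A → ℕ) → ℕ
∑ [] f = 0
∑ (x ∷ xs) f = f x + ∑ xs f

countB≡∑χ : {A : Set} (p : A → Bool) (xs : List A) → countB p xs ≡ ∑ xs (χ ∘ p)
countB≡∑χ p [] = refl
countB≡∑χ p (x ∷ xs) = cong (χ (p x) +_) (countB≡∑χ p xs)

module _ {A : Set} where

  ∑-cong : (xs : List A) {f g : A → ℕ} → (∀ x → f x ≡ g x) → ∑ xs f ≡ ∑ xs g
  ∑-cong [] f≗g = refl
  ∑-cong (x ∷ xs) f≗g = cong₂ _+_ (f≗g x) (∑-cong xs f≗g)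

  ∑-mono : (xs : List A) {f g : A → ℕ} → (∀ x → f x ≤ g x) → ∑ xs f ≤ ∑ xs g
  ∑-mono [] f≤g = z≤n
  ∑-mono (x ∷ xs) f≤g = +-mono-≤ (f≤g x) (∑-mono xs f≤g)

  ∑-zero : (xs : List A) → ∑ xs (λ _ → 0) ≡ 0
  ∑-zero [] = refl
  ∑-zero (x ∷ xs) = ∑-zero xs

  ∑-+ : (xs : List A) (f g : A → ℕ) → ∑ xs (λ x → f x + g x) ≡ ∑ xs f + ∑ xs g
  ∑-+ [] f g = refl
  ∑-+ (x ∷ xs) f g = trans (cong (f x + g x +_) (∑-+ xs f g)) (interchange (f x) (g x) _ _)

  ∑-*ˡ : (xs : List A) (c : ℕ) (f : A → ℕ) → ∑ xs (λ x → c * f x) ≡ c * ∑ xs f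
  ∑-*ˡ [] c f = sym (*-zeroʳ c)
  ∑-*ˡ (x ∷ xs) c f = trans (cong (c * f x +_) (∑-*ˡ xs c f)) (sym (*-distribˡ-+ c (f x) _))

  ∑-++ : (xs ys : List A) (f : A → ℕ) → ∑ (xs ++ ys) f ≡ ∑ xs f + ∑ ys f
  ∑-++ [] ys f = refl
  ∑-++ (x ∷ xs) ys f = trans (cong (f x +_) (∑-++ xs ys f)) (sym (+-assoc (f x) _ _))

∑-swap : {A B : Set} (xs : List A) (ys : List B) (F : A → B → ℕ) →
  ∑ xs (λ x → ∑ ys (F x)) ≡ ∑ ys (λ y → ∑ xs (λ x → F x y))
∑-swap [] ys F = sym (∑-zero ys)
∑-swap (x ∷ xs) ys F =
  trans (cong (∑ ys (F x) +_) (∑-swap xs ys F)) (sym (∑-+ ys (F x) (λ y → ∑ xs (λ x′ → F x′ y))))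

∑-map : {A B : Set} (g : A → B) (xs : List A) (f : B → ℕ) → ∑ (map g xs) f ≡ ∑ xs (f ∘ g)
∑-map g [] f = refl
∑-map g (x ∷ xs) f = cong (f (g x) +_) (∑-map g xs f)

∑-concatMap : {A B : Set} (g : A → List B) (xs : List A) (f : B → ℕ) →
  ∑ (concatMap g xs) f ≡ ∑ xs (λ x → ∑ (g x) f)
∑-concatMap g [] f = refl
∑-concatMap g (x ∷ xs) f =
  trans (∑-++ (g x) (concatMap g xs) f) (cong (∑ (g x) f +_) (∑-concatMap g xs f))

∑Fin : (n : ℕ) → (Fin n → ℕ) → ℕ
∑Fin zero f = 0
∑Fin (suc n) f = f fzero + ∑Fin n (f ∘ fsuc)

∑-tabulate : {A : Set} (n : ℕ) (g : Fin n → A) (f : A → ℕ) → ∑ (tabulate g) f ≡ ∑Fin n (f ∘ g)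
∑-tabulate zero g f = refl
∑-tabulate (suc n) g f = cong (f (g fzero) +_) (∑-tabulate n (g ∘ fsuc) f)

∑Fin-cong : (n : ℕ) {f g : Fin n → ℕ} → (∀ x → f x ≡ g x) → ∑Fin n f ≡ ∑Fin n g
∑Fin-cong zero f≗g = refl
∑Fin-cong (suc n) f≗g = cong₂ _+_ (f≗g fzero) (∑Fin-cong n (f≗g ∘ fsuc))

∑Fin-mono : (n : ℕ) {f g : Fin n → ℕ} → (∀ x → f x ≤ g x) → ∑Fin n f ≤ ∑Fin n g
∑Fin-mono zero f≤g = z≤n
∑Fin-mono (suc n) f≤g = +-mono-≤ (f≤g fzero) (∑Fin-mono n (f≤g ∘ fsuc))

∑Fin-zero : (n : ℕ) → ∑Fin n (λ _ → 0) ≡ 0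
∑Fin-zero zero = refl
∑Fin-zero (suc n) = ∑Fin-zero n

∑Fin-const : (n c : ℕ) → ∑Fin n (λ _ → c) ≡ n * c
∑Fin-const zero c = refl
∑Fin-const (suc n) c = cong (c +_) (∑Fin-const n c)

∑Fin-+ : (n : ℕ) (f g : Fin n → ℕ) → ∑Fin n (λ x → f x + g x) ≡ ∑Fin n f + ∑Fin n g
∑Fin-+ zero f g = refl
∑Fin-+ (suc n) f g =
  trans (cong (f fzero + g fzero +_) (∑Fin-+ n (f ∘ fsuc) (g ∘ fsuc))) (interchange (f fzero) (g fzero) _ _)

∑Fin-*ˡ : (n c : ℕ) (f : Fin n → ℕ) → ∑Fin n (λ x → c * f x) ≡ c * ∑Fin n f
∑Fin-*ˡ zero c f = sym (*-zeroʳ c)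
∑Fin-*ˡ (suc n) c f = trans (cong (c * f fzero +_) (∑Fin-*ˡ n c (f ∘ fsuc))) (sym (*-distribˡ-+ c (f fzero) _))

∑Fin-*ʳ : (n c : ℕ) (f : Fin n → ℕ) → ∑Fin n (λ x → f x * c) ≡ ∑Fin n f * c
∑Fin-*ʳ n c f = trans (∑Fin-cong n (λ x → *-comm (f x) c)) (trans (∑Fin-*ˡ n c f) (*-comm c _))

term≤∑Fin : (n : ℕ) (f : Fin n → ℕ) (x : Fin n) → f x ≤ ∑Fin n f
term≤∑Fin (suc n) f fzero = m≤m+n _ _
term≤∑Fin (suc n) f (fsuc x) = ≤-trans (term≤∑Fin n (f ∘ fsuc) x) (m≤n+m _ _)

∑< : (ℕ → ℕ) → ℕ → ℕ
∑< f n = ∑Fin n (f ∘ toℕ)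

∑<-cong : (m : ℕ) {f g : ℕ → ℕ} → (∀ n → n < m → f n ≡ g n) → ∑< f m ≡ ∑< g m
∑<-cong zero f≗g = refl
∑<-cong (suc m) f≗g = cong₂ _+_ (f≗g 0 z<s) (∑<-cong m (λ n n<m → f≗g (suc n) (s<s n<m)))

∑<-split : (f : ℕ → ℕ) (l m : ℕ) → ∑< f (l + m) ≡ ∑< f l + ∑< (λ n → f (l + n)) m
∑<-split f zero m = refl
∑<-split f (suc l) m = trans (cong (f 0 +_) (∑<-split (f ∘ suc) l m)) (sym (+-assoc (f 0) _ _))

∑<-periodic : (d : ℕ) .{{_ : NonZero d}} (f : ℕ → ℕ) (q : ℕ) → ∑< (λ n → f (n % d)) (q * d) ≡ q * ∑< f d
∑<-periodic d f zero = refl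
∑<-periodic d f (suc q) = begin
  ∑< (f ∘ (_% d)) (d + q * d)                                ≡⟨ ∑<-split (f ∘ (_% d)) d (q * d) ⟩
  ∑< (f ∘ (_% d)) d + ∑< (λ n → f ((d + n) % d)) (q * d)
    ≡⟨ cong₂ _+_ one-period (∑<-cong (q * d) λ n _ → cong f (d+n%d n)) ⟩
  ∑< f d + ∑< (f ∘ (_% d)) (q * d)                           ≡⟨ cong (∑< f d +_) (∑<-periodic d f q) ⟩
  ∑< f d + q * ∑< f d                                        ∎
  where
  open ≡-Reasoning
  one-period : ∑< (f ∘ (_% d)) d ≡ ∑< f d
  one-period = ∑<-cong d λ n n<d → cong f (m<n⇒m%n≡m n<d)
  d+n%d : ∀ n → (d + n) % d ≡ n % d
  d+n%d n = trans (cong (_% d) (+-comm d n)) ([m+n]%n≡m%n n d)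

∑<-χ≡ᵇ≤1 : (c m : ℕ) → ∑< (λ n → χ (n ≡ᵇ c)) m ≤ 1
∑<-χ≡ᵇ≤1 c zero = z≤n
∑<-χ≡ᵇ≤1 zero (suc m) = s≤s (≤-reflexive (∑Fin-zero m))
∑<-χ≡ᵇ≤1 (suc c) (suc m) = ∑<-χ≡ᵇ≤1 c m

-- Counting vertices and adjacent pairs of the grid

∑V : {a₁ a₂ a₃ : ℕ} → (Vertex a₁ a₂ a₃ → ℕ) → ℕ
∑V {a₁} {a₂} {a₃} F = ∑Fin a₁ λ i → ∑Fin a₂ λ j → ∑Fin a₃ λ k → F (i , j , k)

module _ (a₁ a₂ a₃ : ℕ) where

  ∑-vertices : (F : Vertex a₁ a₂ a₃ → ℕ) → ∑ (vertices a₁ a₂ a₃) F ≡ ∑V F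
  ∑-vertices F =
    trans (∑-concatMap _ (allFin a₁) F) (trans (∑-tabulate a₁ _ _) (∑Fin-cong a₁ λ i →
      trans (∑-concatMap _ (allFin a₂) F) (trans (∑-tabulate a₂ _ _) (∑Fin-cong a₂ λ j →
        trans (∑-map _ (allFin a₃) F) (∑-tabulate a₃ _ _)))))

  term≤∑V : (F : Vertex a₁ a₂ a₃ → ℕ) (v : Vertex a₁ a₂ a₃) → F v ≤ ∑V F
  term≤∑V F (i , j , k) =
    ≤-trans (term≤∑Fin a₃ _ k) (≤-trans (term≤∑Fin a₂ (λ j → ∑Fin a₃ λ k → F (i , j , k)) j) (term≤∑Fin a₁ _ i))

  ∑V-const : (c : ℕ) → ∑V {a₁} {a₂} {a₃} (λ _ → c) ≡ a₁ * (a₂ * (a₃ * c))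
  ∑V-const c = begin
    ∑Fin a₁ (λ _ → ∑Fin a₂ λ _ → ∑Fin a₃ λ _ → c) ≡⟨ ∑Fin-cong a₁ (λ _ → ∑Fin-cong a₂ λ _ → ∑Fin-const a₃ c) ⟩
    ∑Fin a₁ (λ _ → ∑Fin a₂ λ _ → a₃ * c)         ≡⟨ ∑Fin-cong a₁ (λ _ → ∑Fin-const a₂ (a₃ * c)) ⟩
    ∑Fin a₁ (λ _ → a₂ * (a₃ * c))                 ≡⟨ ∑Fin-const a₁ _ ⟩
    a₁ * (a₂ * (a₃ * c))                          ∎
    where open ≡-Reasoning

  ∑V-product : (f : Fin a₁ → ℕ) (g : Fin a₂ → ℕ) (h : Fin a₃ → ℕ) →
    ∑V (λ (i , j , k) → f i * (g j * h k)) ≡ ∑Fin a₁ f * (∑Fin a₂ g * ∑Fin a₃ h)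
  ∑V-product f g h =
    trans (∑Fin-cong a₁ λ i → trans (∑Fin-cong a₂ λ j → trans (∑Fin-*ˡ a₃ (f i) _) (cong (f i *_) (∑Fin-*ˡ a₃ (g j) h)))
                               (trans (∑Fin-*ˡ a₂ (f i) _) (cong (f i *_) (∑Fin-*ʳ a₂ (∑Fin a₃ h) g))))
          (∑Fin-*ʳ a₁ _ f)

∑² : (n : ℕ) → (Fin n → Fin n → Bool) → ℕ
∑² n r = ∑Fin n λ x → ∑Fin n λ y → χ (r x y)

∑²-eqF : (n : ℕ) → ∑² n eqF ≡ n
∑²-eqF zero = refl
∑²-eqF (suc n) = cong₂ (λ first rest → suc (first + rest)) (∑Fin-zero n) (∑²-eqF n)

pathPairs : ℕ → ℕ
pathPairs n = ∑² n dist1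

pathPairs-suc : (n : ℕ) → pathPairs (suc n) ≡ 2 * n
pathPairs-suc zero = refl
pathPairs-suc (suc n) = begin
  pathPairs (suc (suc n))
    ≡⟨ cong (endpointDegree +_) (∑Fin-+ (suc n) (λ x → χ (toℕ x ≡ᵇ 0)) (λ x → ∑Fin (suc n) (χ ∘ dist1 x))) ⟩
  endpointDegree + (endpointDegree + pathPairs (suc n))                   ≡⟨ cong₂ (λ z p → z + (z + p)) endpointDegree≡1 (pathPairs-suc n) ⟩
  2 + 2 * n                                               ≡⟨ *-suc 2 n ⟨
  2 * suc n                                               ∎
  where
  open ≡-Reasoning
  endpointDegree : ℕ
  endpointDegree = ∑Fin (suc n) λ y → χ (toℕ y ≡ᵇ 0)
  endpointDegree≡1 : endpointDegree ≡ 1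
  endpointDegree≡1 = cong suc (∑Fin-zero n)

module _ {a₁ a₂ a₃ : ℕ} where
  private
    V : List (Vertex a₁ a₂ a₃)
    V = vertices a₁ a₂ a₃

  ∑∑-vertices : (F : Vertex a₁ a₂ a₃ → Vertex a₁ a₂ a₃ → ℕ) → ∑ V (λ v → ∑ V (F v)) ≡ ∑V (λ v → ∑V (F v))
  ∑∑-vertices F = trans (∑-cong V (λ v → ∑-vertices a₁ a₂ a₃ (F v))) (∑-vertices a₁ a₂ a₃ (λ v → ∑V (F v)))

  ∑∑-separable : (r₁ : Fin a₁ → Fin a₁ → Bool) (r₂ : Fin a₂ → Fin a₂ → Bool) (r₃ : Fin a₃ → Fin a₃ → Bool) →
    ∑ V (λ (i , j , k) → ∑ V (λ (i′ , j′ , k′) → χ (r₁ i i′) * (χ (r₂ j j′) * χ (r₃ k k′))))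
      ≡ ∑² a₁ r₁ * (∑² a₂ r₂ * ∑² a₃ r₃)
  ∑∑-separable r₁ r₂ r₃ =
    trans (∑∑-vertices _)
      (trans (∑V-cong (λ (i , j , k) → ∑V-product a₁ a₂ a₃ (χ ∘ r₁ i) (χ ∘ r₂ j) (χ ∘ r₃ k)))
             (∑V-product a₁ a₂ a₃ (λ i → ∑Fin a₁ (χ ∘ r₁ i)) (λ j → ∑Fin a₂ (χ ∘ r₂ j)) (λ k → ∑Fin a₃ (χ ∘ r₃ k))))
    where
    ∑V-cong : {F G : Vertex a₁ a₂ a₃ → ℕ} → (∀ v → F v ≡ G v) → ∑V F ≡ ∑V G
    ∑V-cong F≗G = ∑Fin-cong a₁ λ i → ∑Fin-cong a₂ λ j → ∑Fin-cong a₃ λ k → F≗G (i , j , k)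

adjacentPairs : (a₁ a₂ a₃ : ℕ) → ℕ
adjacentPairs a₁ a₂ a₃ = ∑ V λ v → ∑ V λ w → χ (adj v w)
  where V = vertices a₁ a₂ a₃

adjacentPairs-≤ : (a₁ a₂ a₃ : ℕ) →
  adjacentPairs a₁ a₂ a₃ ≤ pathPairs a₁ * (a₂ * a₃) + (a₁ * (pathPairs a₂ * a₃) + a₁ * (a₂ * pathPairs a₃))
adjacentPairs-≤ a₁ a₂ a₃ = begin
  adjacentPairs a₁ a₂ a₃
    ≤⟨ ∑-mono V (λ v → ∑-mono V (adj≤ v)) ⟩
  ∑ V (λ v → ∑ V λ w → along₁ v w + (along₂ v w + along₃ v w))
    ≡⟨ ∑-cong V (λ v → trans (∑-+ V _ _) (cong (∑ V (along₁ v) +_) (∑-+ V _ _))) ⟩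
  ∑ V (λ v → ∑ V (along₁ v) + (∑ V (along₂ v) + ∑ V (along₃ v)))
    ≡⟨ trans (∑-+ V _ _) (cong (∑∑ along₁ +_) (∑-+ V _ _)) ⟩
  ∑∑ along₁ + (∑∑ along₂ + ∑∑ along₃)
    ≡⟨ cong₂ _+_ (separable dist1 eqF eqF) (cong₂ _+_ (separable eqF dist1 eqF) (separable eqF eqF dist1)) ⟩
  pathPairs a₁ * (∑² a₂ eqF * ∑² a₃ eqF)
    + (∑² a₁ eqF * (pathPairs a₂ * ∑² a₃ eqF) + ∑² a₁ eqF * (∑² a₂ eqF * pathPairs a₃))
    ≡⟨ cong₂ _+_ (cong (pathPairs a₁ *_) (cong₂ _*_ e₂ e₃))
                 (cong₂ _+_ (cong₂ _*_ e₁ (cong (pathPairs a₂ *_) e₃)) (cong₂ _*_ e₁ (cong (_* pathPairs a₃) e₂))) ⟩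
  pathPairs a₁ * (a₂ * a₃) + (a₁ * (pathPairs a₂ * a₃) + a₁ * (a₂ * pathPairs a₃)) ∎
  where
  open ≤-Reasoning
  V = vertices a₁ a₂ a₃
  separable = ∑∑-separable {a₁} {a₂} {a₃}
  e₁ = ∑²-eqF a₁
  e₂ = ∑²-eqF a₂
  e₃ = ∑²-eqF a₃
  along₁ along₂ along₃ : Vertex a₁ a₂ a₃ → Vertex a₁ a₂ a₃ → ℕ
  along₁ (i , j , k) (i′ , j′ , k′) = χ (dist1 i i′) * (χ (eqF j j′) * χ (eqF k k′))
  along₂ (i , j , k) (i′ , j′ , k′) = χ (eqF i i′) * (χ (dist1 j j′) * χ (eqF k k′))
  along₃ (i , j , k) (i′ , j′ , k′) = χ (eqF i i′) * (χ (eqF j j′) * χ (dist1 k k′))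
  ∑∑ : (Vertex a₁ a₂ a₃ → Vertex a₁ a₂ a₃ → ℕ) → ℕ
  ∑∑ F = ∑ V λ v → ∑ V (F v)
  χ-∧₃ : (b c d : Bool) → χ (b ∧ c ∧ d) ≡ χ b * (χ c * χ d)
  χ-∧₃ b c d = trans (χ-∧ b (c ∧ d)) (cong (χ b *_) (χ-∧ c d))
  adj≤ : ∀ v w → χ (adj v w) ≤ along₁ v w + (along₂ v w + along₃ v w)
  adj≤ (i , j , k) (i′ , j′ , k′) =
    ≤-trans (χ-∨ (dist1 i i′ ∧ eqF j j′ ∧ eqF k k′) _)
      (+-mono-≤ (≤-reflexive (χ-∧₃ (dist1 i i′) (eqF j j′) (eqF k k′)))
        (≤-trans (χ-∨ (eqF i i′ ∧ dist1 j j′ ∧ eqF k k′) _)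
          (+-mono-≤ (≤-reflexive (χ-∧₃ (eqF i i′) (dist1 j j′) (eqF k k′)))
                    (≤-reflexive (χ-∧₃ (eqF i i′) (eqF j j′) (dist1 k k′))))))

-- The perimeter bound

≡ᵇ-sym : (m n : ℕ) → (m ≡ᵇ n) ≡ (n ≡ᵇ m)
≡ᵇ-sym zero zero = refl
≡ᵇ-sym zero (suc n) = refl
≡ᵇ-sym (suc m) zero = refl
≡ᵇ-sym (suc m) (suc n) = ≡ᵇ-sym m n

adj-sym : {a₁ a₂ a₃ : ℕ} (v w : Vertex a₁ a₂ a₃) → adj v w ≡ adj w v
adj-sym (i , j , k) (i′ , j′ , k′)
  rewrite ≡ᵇ-sym (toℕ i) (toℕ i′) | ≡ᵇ-sym (toℕ j) (toℕ j′) | ≡ᵇ-sym (toℕ k) (toℕ k′)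
        | ∣-∣-comm (toℕ i) (toℕ i′) | ∣-∣-comm (toℕ j) (toℕ j′) | ∣-∣-comm (toℕ k) (toℕ k′) = refl

module _ {a₁ a₂ a₃ : ℕ} where
  private
    V : List (Vertex a₁ a₂ a₃)
    V = vertices a₁ a₂ a₃

  size≡∑ : (B : VSet a₁ a₂ a₃) → size B ≡ ∑ V (χ ∘ B)
  size≡∑ B = countB≡∑χ B V

  crossPairs : VSet a₁ a₂ a₃ → VSet a₁ a₂ a₃ → ℕ
  crossPairs B C = ∑ V λ v → ∑ V λ w → χ (adj v w ∧ B v ∧ C w)

  crossPairs-comm : (B C : VSet a₁ a₂ a₃) → crossPairs B C ≡ crossPairs C B
  crossPairs-comm B C = trans (∑-swap V V _) (∑-cong V λ w → ∑-cong V λ v →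
    cong χ (cong₂ _∧_ (adj-sym v w) (∧-comm (B v) (C w))))

  crossPairs≤adjacentPairs : (B C : VSet a₁ a₂ a₃) → crossPairs B C ≤ adjacentPairs a₁ a₂ a₃
  crossPairs≤adjacentPairs B C = ∑-mono V λ v → ∑-mono V λ w → χ-∧≤ (adj v w) (B v ∧ C w)
    where
    χ-∧≤ : (b c : Bool) → χ (b ∧ c) ≤ χ b
    χ-∧≤ true c = χ≤1 c
    χ-∧≤ false c = z≤n

  3*size≤crossPairs : (B C : VSet a₁ a₂ a₃) → (∀ v → T (C v) → 3 ≤ nbrsIn B v) → 3 * size C ≤ crossPairs C B
  3*size≤crossPairs B C many = begin
    3 * size C                    ≡⟨ cong (3 *_) (size≡∑ C) ⟩
    3 * ∑ V (χ ∘ C)               ≡⟨ ∑-*ˡ V 3 (χ ∘ C) ⟨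
    ∑ V (λ v → 3 * χ (C v))
      ≤⟨ ∑-mono V (λ v → pointwise {v} (C v) (many v) (countB≡∑χ (λ w → adj v w ∧ B w) V)) ⟩
    crossPairs C B                ∎
    where
    open ≤-Reasoning
    pointwise : ∀ {v} (c : Bool) {m} → (T c → 3 ≤ m) → m ≡ ∑ V (λ w → χ (adj v w ∧ B w)) →
                3 * χ c ≤ ∑ V (λ w → χ (adj v w ∧ c ∧ B w))
    pointwise false _ _ = z≤n
    pointwise true 3≤m refl = 3≤m _

  fresh : VSet a₁ a₂ a₃ → VSet a₁ a₂ a₃
  fresh B v = not (B v) ∧ (3 ≤ᵇ nbrsIn B v)

  size-step : (B : VSet a₁ a₂ a₃) → size (step B) ≡ size B + size (fresh B)
  size-step B = begin
    size (step B)                              ≡⟨ size≡∑ (step B) ⟩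
    ∑ V (χ ∘ step B)                           ≡⟨ ∑-cong V (λ v → χ-∨-disjoint (B v) _) ⟩
    ∑ V (λ v → χ (B v) + χ (fresh B v))        ≡⟨ ∑-+ V (χ ∘ B) (χ ∘ fresh B) ⟩
    ∑ V (χ ∘ B) + ∑ V (χ ∘ fresh B)            ≡⟨ cong₂ _+_ (size≡∑ B) (size≡∑ (fresh B)) ⟨
    size B + size (fresh B)                    ∎
    where open ≡-Reasoning

  crossPairs-step : (B : VSet a₁ a₂ a₃) →
    crossPairs B B + crossPairs B (fresh B) + crossPairs (fresh B) B ≤ crossPairs (step B) (step B)
  crossPairs-step B = begin
    crossPairs B B + crossPairs B (fresh B) + crossPairs (fresh B) B
      ≡⟨ cong (_+ crossPairs (fresh B) B) (∑-+ V _ _) ⟨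
    ∑ V (λ v → ∑ V (pair B B v) + ∑ V (pair B (fresh B) v)) + crossPairs (fresh B) B
      ≡⟨ ∑-+ V _ _ ⟨
    ∑ V (λ v → ∑ V (pair B B v) + ∑ V (pair B (fresh B) v) + ∑ V (pair (fresh B) B v))
      ≡⟨ ∑-cong V (λ v → trans (∑-+ V _ _) (cong (_+ ∑ V (pair (fresh B) B v)) (∑-+ V _ _))) ⟨
    ∑ V (λ v → ∑ V λ w → pair B B v w + pair B (fresh B) v w + pair (fresh B) B v w)
      ≤⟨ ∑-mono V (λ v → ∑-mono V λ w → pointwise (adj v w) (B v) _ (B w) _) ⟩
    crossPairs (step B) (step B) ∎
    where
    open ≤-Reasoning
    pair : VSet a₁ a₂ a₃ → VSet a₁ a₂ a₃ → Vertex a₁ a₂ a₃ → Vertex a₁ a₂ a₃ → ℕ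
    pair C D v w = χ (adj v w ∧ C v ∧ D w)
    pointwise : ∀ e b x c y → χ (e ∧ b ∧ c) + χ (e ∧ b ∧ not c ∧ y) + χ (e ∧ (not b ∧ x) ∧ c)
                             ≤ χ (e ∧ (b ∨ x) ∧ (c ∨ y))
    pointwise false _ _ _ _ = z≤n
    pointwise true true _ c y = ≤-reflexive (trans (+-identityʳ _) (sym (χ-∨-disjoint c y)))
    pointwise true false false _ _ = z≤n
    pointwise true false true false _ = z≤n
    pointwise true false true true _ = ≤-refl

  perimeter-step : (B : VSet a₁ a₂ a₃) →
    6 * size (step B) + crossPairs B B ≤ 6 * size B + crossPairs (step B) (step B)
  perimeter-step B = begin
    6 * size (step B) + P                    ≡⟨ cong (λ s → 6 * s + P) (size-step B) ⟩
    6 * (size B + n) + P                     ≡⟨ rearrange (size B) n P ⟩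
    6 * size B + (P + 3 * n + 3 * n)         ≤⟨ +-monoʳ-≤ (6 * size B) (+-mono-≤ (+-monoʳ-≤ P 3n≤D₁) 3n≤D₂) ⟩
    6 * size B + (P + D₁ + D₂)               ≤⟨ +-monoʳ-≤ (6 * size B) (crossPairs-step B) ⟩
    6 * size B + crossPairs (step B) (step B) ∎
    where
    open ≤-Reasoning
    n = size (fresh B)
    P = crossPairs B B
    D₁ = crossPairs B (fresh B)
    D₂ = crossPairs (fresh B) B
    rearrange : ∀ s n p → 6 * (s + n) + p ≡ 6 * s + (p + 3 * n + 3 * n)
    rearrange = solve-∀
    3n≤D₂ : 3 * n ≤ D₂
    3n≤D₂ = 3*size≤crossPairs B (fresh B) enough
      where
      enough : ∀ v → T (fresh B v) → 3 ≤ nbrsIn B v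
      enough v isFresh with B v
      ... | false = ≤ᵇ⇒≤ 3 (nbrsIn B v) isFresh
    3n≤D₁ : 3 * n ≤ D₁
    3n≤D₁ = ≤-trans 3n≤D₂ (≤-reflexive (crossPairs-comm (fresh B) B))

  module _ (A : VSet a₁ a₂ a₃) where

    perimeter-stage : ∀ t → 6 * size (stage A t) + crossPairs A A ≤ 6 * size A + crossPairs (stage A t) (stage A t)
    perimeter-stage zero = ≤-refl
    perimeter-stage (suc t) = +-cancelʳ-≤ (6 * size B + crossPairs B B) _ _ (begin
      6 * size (step B) + crossPairs A A + (6 * size B + crossPairs B B)
        ≡⟨ swap (6 * size (step B)) (crossPairs A A) (6 * size B) (crossPairs B B) ⟩
      (6 * size (step B) + crossPairs B B) + (6 * size B + crossPairs A A)
        ≤⟨ +-mono-≤ (perimeter-step B) (perimeter-stage t) ⟩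
      (6 * size B + crossPairs (step B) (step B)) + (6 * size A + crossPairs B B)
        ≡⟨ swap′ (6 * size B) (crossPairs (step B) (step B)) (6 * size A) (crossPairs B B) ⟩
      6 * size A + crossPairs (step B) (step B) + (6 * size B + crossPairs B B) ∎)
      where
      open ≤-Reasoning
      B = stage A t
      swap : ∀ p q r s → p + q + (r + s) ≡ (p + s) + (r + q)
      swap = solve-∀
      swap′ : ∀ p q r s → (p + q) + (r + s) ≡ r + q + (p + s)
      swap′ = solve-∀

    Eventually : Vertex a₁ a₂ a₃ → Set
    Eventually v = ∃ λ t → stage A t v ≡ true

    stage-+ : ∀ s t v → stage A t v ≡ true → stage A (s + t) v ≡ true
    stage-+ zero t v infected = infected
    stage-+ (suc s) t v infected rewrite stage-+ s t v infected = refl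

    stage-mono : ∀ {t t′} v → t ≤ t′ → stage A t v ≡ true → stage A t′ v ≡ true
    stage-mono {t} {t′} v t≤t′ infected = subst (λ s → stage A s v ≡ true) (m∸n+n≡m t≤t′) (stage-+ (t′ ∸ t) t v infected)

    percolation-time : Percolates A → (xs : List (Vertex a₁ a₂ a₃)) → ∃ λ t → ∑ xs (λ _ → 1) ≤ ∑ xs (χ ∘ stage A t)
    percolation-time perc [] = 0 , z≤n
    percolation-time perc (x ∷ xs) with perc x | percolation-time perc xs
    ... | t , x-infected | T , xs-infected =
      t + T , +-mono-≤ (≤-reflexive (cong χ (sym (stage-mono x (m≤m+n t T) x-infected))))
                       (≤-trans xs-infected (∑-mono xs (χ-stage-mono (m≤n+m T t))))
      where
      χ-stage-mono : ∀ {t t′} → t ≤ t′ → ∀ v → χ (stage A t v) ≤ χ (stage A t′ v)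
      χ-stage-mono {t} t≤t′ v with stage A t v in infected
      ... | false = z≤n
      ... | true = ≤-reflexive (cong χ (sym (stage-mono v t≤t′ infected)))

    6*volume≤ : Percolates A → 6 * (a₁ * (a₂ * a₃)) ≤ 6 * size A + adjacentPairs a₁ a₂ a₃
    6*volume≤ perc with percolation-time perc V
    ... | T , all-infected = begin
      6 * (a₁ * (a₂ * a₃))                                ≡⟨ cong (6 *_) volume ⟨
      6 * ∑ V (λ _ → 1)                                   ≤⟨ *-monoʳ-≤ 6 all-infected ⟩
      6 * ∑ V (χ ∘ stage A T)                             ≡⟨ cong (6 *_) (size≡∑ (stage A T)) ⟨
      6 * size (stage A T)                                ≤⟨ m≤m+n _ _ ⟩
      6 * size (stage A T) + crossPairs A A               ≤⟨ perimeter-stage T ⟩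
      6 * size A + crossPairs (stage A T) (stage A T)
        ≤⟨ +-monoʳ-≤ (6 * size A) (crossPairs≤adjacentPairs (stage A T) (stage A T)) ⟩
      6 * size A + adjacentPairs a₁ a₂ a₃                 ∎
      where
      open ≤-Reasoning
      volume : ∑ V (λ _ → 1) ≡ a₁ * (a₂ * a₃)
      volume = trans (∑-vertices a₁ a₂ a₃ (λ _ → 1))
                     (trans (∑V-const a₁ a₂ a₃ 1) (cong (λ c → a₁ * (a₂ * c)) (*-identityʳ a₃)))

σ/3≤size : ∀ {n₁ n₂ n₃} (A : VSet (suc n₁) (suc n₂) (suc n₃)) → Percolates A →
  σ (suc n₁) (suc n₂) (suc n₃) / 3 ≤ size A
σ/3≤size {n₁} {n₂} {n₃} A perc = *-cancelˡ-≤ 6 (begin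
  6 * (s / 3)              ≡⟨ *-assoc 2 3 (s / 3) ⟩
  2 * (3 * (s / 3))        ≤⟨ *-monoʳ-≤ 2 (≤-trans (≤-reflexive (*-comm 3 (s / 3))) (m/n*n≤m s 3)) ⟩
  2 * s                    ≤⟨ +-cancelʳ-≤ E (2 * s) (6 * size A) 2s+E≤6size+E ⟩
  6 * size A               ∎)
  where
  open ≤-Reasoning
  a₁ = suc n₁
  a₂ = suc n₂
  a₃ = suc n₃
  s = σ a₁ a₂ a₃
  E = pathPairs a₁ * (a₂ * a₃) + (a₁ * (pathPairs a₂ * a₃) + a₁ * (a₂ * pathPairs a₃))
  handshake : 2 * s + E ≡ 6 * (a₁ * (a₂ * a₃))
  handshake rewrite pathPairs-suc n₁ | pathPairs-suc n₂ | pathPairs-suc n₃ = identity n₁ n₂ n₃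
    where
    identity : ∀ x y z → 2 * (suc x * suc y + suc x * suc z + suc y * suc z)
                         + (2 * x * (suc y * suc z) + (suc x * (2 * y * suc z) + suc x * (suc y * (2 * z))))
                       ≡ 6 * (suc x * (suc y * suc z))
    identity = solve-∀
  2s+E≤6size+E : 2 * s + E ≤ 6 * size A + E
  2s+E≤6size+E = begin
    2 * s + E                             ≡⟨ handshake ⟩
    6 * (a₁ * (a₂ * a₃))                  ≤⟨ 6*volume≤ A perc ⟩
    6 * size A + adjacentPairs a₁ a₂ a₃   ≤⟨ +-monoʳ-≤ (6 * size A) (adjacentPairs-≤ a₁ a₂ a₃) ⟩
    6 * size A + E                        ∎

-- Certified infection inside windows

_≟ᵛ_ : {a₁ a₂ a₃ : ℕ} → DecidableEquality (Vertex a₁ a₂ a₃)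
_≟ᵛ_ = ≡-dec Fin._≟_ (≡-dec Fin._≟_ Fin._≟_)

module _ {a₁ a₂ a₃ : ℕ} where
  private
    V : List (Vertex a₁ a₂ a₃)
    V = vertices a₁ a₂ a₃

  3≤countB : (p : Vertex a₁ a₂ a₃ → Bool) {w₁ w₂ w₃ : Vertex a₁ a₂ a₃} →
    w₁ ≢ w₂ → w₁ ≢ w₃ → w₂ ≢ w₃ → T (p w₁) → T (p w₂) → T (p w₃) → 3 ≤ countB p V
  3≤countB p {w₁} {w₂} {w₃} w₁≢w₂ w₁≢w₃ w₂≢w₃ p₁ p₂ p₃ = begin
    3                                                   ≤⟨ +-mono-≤ (+-mono-≤ (one∈V w₁) (one∈V w₂)) (one∈V w₃) ⟩
    ∑ V (is w₁) + ∑ V (is w₂) + ∑ V (is w₃)             ≡⟨ cong (_+ ∑ V (is w₃)) (∑-+ V (is w₁) (is w₂)) ⟨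
    ∑ V (λ w → is w₁ w + is w₂ w) + ∑ V (is w₃)         ≡⟨ ∑-+ V (λ w → is w₁ w + is w₂ w) (is w₃) ⟨
    ∑ V (λ w → is w₁ w + is w₂ w + is w₃ w)             ≤⟨ ∑-mono V pointwise ⟩
    ∑ V (χ ∘ p)                                         ≡⟨ countB≡∑χ p V ⟨
    countB p V                                          ∎
    where
    open ≤-Reasoning
    is : Vertex a₁ a₂ a₃ → Vertex a₁ a₂ a₃ → ℕ
    is u w = χ (does (w ≟ᵛ u))
    one∈V : ∀ u → 1 ≤ ∑ V (is u)
    one∈V u = begin
      1           ≡⟨ cong χ (dec-true (u ≟ᵛ u) refl) ⟨
      is u u      ≤⟨ term≤∑V a₁ a₂ a₃ (is u) u ⟩
      ∑V (is u)   ≡⟨ ∑-vertices a₁ a₂ a₃ (is u) ⟨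
      ∑ V (is u)  ∎
    1≤χ : {b : Bool} → T b → 1 ≤ χ b
    1≤χ {true} _ = ≤-refl
    pointwise : ∀ w → is w₁ w + is w₂ w + is w₃ w ≤ χ (p w)
    pointwise w with w ≟ᵛ w₁ | w ≟ᵛ w₂ | w ≟ᵛ w₃
    ... | yes refl | yes refl | _        = contradiction refl w₁≢w₂
    ... | yes refl | no _     | yes refl = contradiction refl w₁≢w₃
    ... | no _     | yes refl | yes refl = contradiction refl w₂≢w₃
    ... | yes refl | no _     | no _     = 1≤χ p₁
    ... | no _     | yes refl | no _     = 1≤χ p₂
    ... | no _     | no _     | yes refl = 1≤χ p₃
    ... | no _     | no _     | no _     = z≤n

  eventually-by-three : (A : VSet a₁ a₂ a₃) {v w₁ w₂ w₃ : Vertex a₁ a₂ a₃} →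
    T (adj v w₁) → T (adj v w₂) → T (adj v w₃) → w₁ ≢ w₂ → w₁ ≢ w₃ → w₂ ≢ w₃ →
    Eventually A w₁ → Eventually A w₂ → Eventually A w₃ → Eventually A v
  eventually-by-three A {v} v~w₁ v~w₂ v~w₃ w₁≢w₂ w₁≢w₃ w₂≢w₃ (t₁ , w₁∈) (t₂ , w₂∈) (t₃ , w₃∈) =
    suc t , trans (cong (stage A t v ∨_) (T⇒≡true (≤⇒≤ᵇ three-neighbours))) (∨-zeroʳ (stage A t v))
    where
    t = t₁ + t₂ + t₃
    infectedNeighbour : ∀ {w tᵢ} → T (adj v w) → tᵢ ≤ t → stage A tᵢ w ≡ true → T (adj v w ∧ stage A t w)
    infectedNeighbour {w} v~w tᵢ≤t w∈ = ∧-intro v~w (≡true⇒T (stage-mono A w tᵢ≤t w∈))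
    three-neighbours : 3 ≤ nbrsIn (stage A t) v
    three-neighbours = 3≤countB (λ w → adj v w ∧ stage A t w) w₁≢w₂ w₁≢w₃ w₂≢w₃
      (infectedNeighbour v~w₁ (≤-trans (m≤m+n t₁ t₂) (m≤m+n _ t₃)) w₁∈)
      (infectedNeighbour v~w₂ (≤-trans (m≤n+m t₂ t₁) (m≤m+n _ t₃)) w₂∈)
      (infectedNeighbour v~w₃ (m≤n+m t₃ (t₁ + t₂)) w₃∈)

-- A move (v , n₁ , n₂ , n₃) infects v through its three neighbours nᵢ
Move : ℕ → ℕ → ℕ → Set
Move a₁ a₂ a₃ = Vertex a₁ a₂ a₃ × Vertex a₁ a₂ a₃ × Vertex a₁ a₂ a₃ × Vertex a₁ a₂ a₃

module _ {a₁ a₂ a₃ : ℕ} where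

  LegalMove : VSet a₁ a₂ a₃ → Move a₁ a₂ a₃ → Set
  LegalMove K (v , n₁ , n₂ , n₃) =
    (T (K n₁) × T (K n₂) × T (K n₃))
    × (T (adj v n₁) × T (adj v n₂) × T (adj v n₃))
    × (n₁ ≢ n₂ × n₁ ≢ n₃ × n₂ ≢ n₃)

  legalMove? : (K : VSet a₁ a₂ a₃) (m : Move a₁ a₂ a₃) → Dec (LegalMove K m)
  legalMove? K (v , n₁ , n₂ , n₃) =
    (T? (K n₁) ×-dec T? (K n₂) ×-dec T? (K n₃)) ×-dec (T? (adj v n₁) ×-dec T? (adj v n₂) ×-dec T? (adj v n₃))
      ×-dec (¬? (n₁ ≟ᵛ n₂) ×-dec ¬? (n₁ ≟ᵛ n₃) ×-dec ¬? (n₂ ≟ᵛ n₃))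

  insert : Vertex a₁ a₂ a₃ → VSet a₁ a₂ a₃ → VSet a₁ a₂ a₃
  insert v K u = does (u ≟ᵛ v) ∨ K u

  _∪_ : VSet a₁ a₂ a₃ → VSet a₁ a₂ a₃ → VSet a₁ a₂ a₃
  (K ∪ L) u = K u ∨ L u

  play : VSet a₁ a₂ a₃ → List (Move a₁ a₂ a₃) → VSet a₁ a₂ a₃
  play K [] = K
  play K ((v , _) ∷ ms) = play (insert v K) ms

  legalPlay : VSet a₁ a₂ a₃ → List (Move a₁ a₂ a₃) → Bool
  legalPlay K [] = true
  legalPlay K (m@(v , _) ∷ ms) = ⌊ legalMove? K m ⌋ ∧ legalPlay (insert v K) ms

  _⊆_ : VSet a₁ a₂ a₃ → VSet a₁ a₂ a₃ → Set
  G ⊆ K = ∀ i j k → T (G (i , j , k)) → T (K (i , j , k))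

  _⊆?_ : (G K : VSet a₁ a₂ a₃) → Dec (G ⊆ K)
  G ⊆? K = Fin.all? λ i → Fin.all? λ j → Fin.all? λ k → T? (G (i , j , k)) →-dec T? (K (i , j , k))

  Certifies : VSet a₁ a₂ a₃ → List (Move a₁ a₂ a₃) → VSet a₁ a₂ a₃ → Set
  Certifies K ms G = T (legalPlay K ms ∧ ⌊ G ⊆? play K ms ⌋)

-- The layers o, …, o + w - 1 of [a₁] × [a₂] × [a], seen as the grid [a₁] × [a₂] × [w]
module Window {a₁ a₂ a : ℕ} (A : VSet a₁ a₂ a) (o w : ℕ) (o+w≤a : o + w ≤ a) where

  shift : Fin w → Fin a
  shift k = Fin.inject≤ (o Fin.↑ʳ k) o+w≤a

  toℕ-shift : ∀ k → toℕ (shift k) ≡ o + toℕ k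
  toℕ-shift k = trans (toℕ-inject≤ (o Fin.↑ʳ k) o+w≤a) (toℕ-↑ʳ o k)

  embed : Vertex a₁ a₂ w → Vertex a₁ a₂ a
  embed (i , j , k) = i , j , shift k

  embed-injective : ∀ {u u′} → embed u ≡ embed u′ → u ≡ u′
  embed-injective {i , j , k} {i′ , j′ , k′} eq =
    cong₂ _,_ (cong proj₁ eq) (cong₂ _,_ (cong (proj₁ ∘ proj₂) eq) (toℕ-injective (+-cancelˡ-≡ o _ _
      (trans (sym (toℕ-shift k)) (trans (cong (toℕ ∘ proj₂ ∘ proj₂) eq) (toℕ-shift k′))))))

  adj-embed : ∀ u u′ → adj (embed u) (embed u′) ≡ adj u u′
  adj-embed (i , j , k) (i′ , j′ , k′) = cong₂
    (λ e d → (dist1 i i′ ∧ eqF j j′ ∧ e) ∨ (eqF i i′ ∧ dist1 j j′ ∧ e) ∨ (eqF i i′ ∧ eqF j j′ ∧ d))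
    (trans (cong₂ _≡ᵇ_ (toℕ-shift k) (toℕ-shift k′)) (≡ᵇ-+ˡ o))
    (cong (_≡ᵇ 1) (trans (cong₂ ∣_-_∣ (toℕ-shift k) (toℕ-shift k′)) (∣m+n-m+o∣≡∣n-o∣ o (toℕ k) (toℕ k′))))
    where
    ≡ᵇ-+ˡ : ∀ m {x y} → (m + x ≡ᵇ m + y) ≡ (x ≡ᵇ y)
    ≡ᵇ-+ˡ zero = refl
    ≡ᵇ-+ˡ (suc m) = ≡ᵇ-+ˡ m

  embed-onto : ∀ i j (k : Fin a) {r} (r<w : r < w) → toℕ k ≡ o + r → embed (i , j , Fin.fromℕ< r<w) ≡ (i , j , k)
  embed-onto i j k r<w k≡o+r =
    cong (λ k′ → i , j , k′) (toℕ-injective (trans (toℕ-shift _) (trans (cong (o +_) (toℕ-fromℕ< r<w)) (sym k≡o+r))))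

  Known : VSet a₁ a₂ w → Set
  Known K = ∀ u → T (K u) → Eventually A (embed u)

  known-∪ : ∀ {K L} → Known K → Known L → Known (K ∪ L)
  known-∪ {K} knownK knownL u u∈K∪L with K u in eq
  ... | true = knownK u (≡true⇒T eq)
  ... | false = knownL u u∈K∪L

  known-play : ∀ K ms → Known K → T (legalPlay K ms) → Known (play K ms)
  known-play K [] knownK _ = knownK
  known-play K (m@(v , n₁ , n₂ , n₃) ∷ ms) knownK legal
    with ∧-elim {⌊ legalMove? K m ⌋} legal
  ... | legal-m , legal-ms = known-play (insert v K) ms known-insert legal-ms
    where
    v-eventually : Eventually A (embed v)
    v-eventually with toWitness {a? = legalMove? K m} legal-m
    ... | (n₁∈K , n₂∈K , n₃∈K) , (v~n₁ , v~n₂ , v~n₃) , (n₁≢n₂ , n₁≢n₃ , n₂≢n₃) =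
      eventually-by-three A (adjacent v~n₁) (adjacent v~n₂) (adjacent v~n₃)
        (n₁≢n₂ ∘ embed-injective) (n₁≢n₃ ∘ embed-injective) (n₂≢n₃ ∘ embed-injective)
        (knownK n₁ n₁∈K) (knownK n₂ n₂∈K) (knownK n₃ n₃∈K)
      where
      adjacent : ∀ {n} → T (adj v n) → T (adj (embed v) (embed n))
      adjacent {n} = subst T (sym (adj-embed v n))
    known-insert : Known (insert v K)
    known-insert u u∈ with u ≟ᵛ v
    ... | yes refl = v-eventually
    ... | no _ = knownK u u∈

  certified : ∀ {K G} ms → Certifies K ms G → Known K → Known G
  certified {K} {G} ms certificate knownK (i , j , k) u∈G
    with ∧-elim {legalPlay K ms} certificate
  ... | legal , covered = known-play K ms knownK legal (i , j , k) (toWitness {a? = G ⊆? play K ms} covered i j k u∈G)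

  eventually-layer : ∀ {G} → Known G → ∀ i j (k : Fin a) {r} (r<w : r < w) → toℕ k ≡ o + r →
    T (G (i , j , Fin.fromℕ< r<w)) → Eventually A (i , j , k)
  eventually-layer knownG i j k r<w k≡o+r u∈G =
    subst (Eventually A) (embed-onto i j k r<w k≡o+r) (knownG (i , j , Fin.fromℕ< r<w) u∈G)

-- The seeds for [2] × [3] × [6q]

motif : ℕ → ℕ → ℕ → Bool
motif 0 0 0 = true
motif 0 0 2 = true
motif 1 1 0 = true
motif 2 0 0 = true
motif 2 0 2 = true
motif 3 0 1 = true
motif 3 1 0 = true
motif 4 0 2 = true
motif 5 0 1 = true
motif 5 1 0 = true
motif _ _ _ = false

bottomColumn lateColumn : Fin 2 → Fin 3 → Bool
bottomColumn i j = (toℕ i ≡ᵇ 1) ∧ (toℕ j ≡ᵇ 1)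
lateColumn i j = (toℕ i ≡ᵇ 1) ∧ (toℕ j ≡ᵇ 2)

seedColumn : ℕ → Fin 2 → Fin 3 → ℕ → Bool
seedColumn a i j n = (bottomColumn i j ∧ (n ≡ᵇ 0)) ∨ (lateColumn i j ∧ (n ≡ᵇ a ∸ 1)) ∨ motif (n % 6) (toℕ i) (toℕ j)

seeds : (a : ℕ) → VSet 2 3 a
seeds a (i , j , k) = seedColumn a i j (toℕ k)

motifCount : Fin 2 → Fin 3 → ℕ
motifCount i j = ∑< (λ r → χ (motif r (toℕ i) (toℕ j))) 6

seedColumn-count : (q : ℕ) (i : Fin 2) (j : Fin 3) →
  ∑< (χ ∘ seedColumn (q * 6) i j) (q * 6) ≤ χ (bottomColumn i j) + (χ (lateColumn i j) + q * motifCount i j)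
seedColumn-count q i j = begin
  ∑< (χ ∘ seedColumn a i j) a                   ≤⟨ ∑Fin-mono a (pointwise ∘ toℕ) ⟩
  ∑< (λ n → bottom n + (late n + periodic n)) a
    ≡⟨ trans (∑Fin-+ a (bottom ∘ toℕ) _) (cong (∑< bottom a +_) (∑Fin-+ a (late ∘ toℕ) (periodic ∘ toℕ))) ⟩
  ∑< bottom a + (∑< late a + ∑< periodic a)
    ≡⟨ cong₂ _+_ (∑Fin-*ˡ a cb _) (cong₂ _+_ (∑Fin-*ˡ a cl _) (∑<-periodic 6 (λ r → χ (motif r (toℕ i) (toℕ j))) q)) ⟩
  cb * ∑< (λ n → χ (n ≡ᵇ 0)) a + (cl * ∑< (λ n → χ (n ≡ᵇ a ∸ 1)) a + q * motifCount i j)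
    ≤⟨ +-mono-≤ (*-monoʳ-≤ cb (∑<-χ≡ᵇ≤1 0 a)) (+-monoˡ-≤ _ (*-monoʳ-≤ cl (∑<-χ≡ᵇ≤1 (a ∸ 1) a))) ⟩
  cb * 1 + (cl * 1 + q * motifCount i j)
    ≡⟨ cong₂ _+_ (*-identityʳ cb) (cong (_+ q * motifCount i j) (*-identityʳ cl)) ⟩
  cb + (cl + q * motifCount i j) ∎
  where
  open ≤-Reasoning
  a = q * 6
  cb = χ (bottomColumn i j)
  cl = χ (lateColumn i j)
  bottom late periodic : ℕ → ℕ
  bottom n = cb * χ (n ≡ᵇ 0)
  late n = cl * χ (n ≡ᵇ a ∸ 1)
  periodic n = χ (motif (n % 6) (toℕ i) (toℕ j))
  pointwise : ∀ n → χ (seedColumn a i j n) ≤ bottom n + (late n + periodic n)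
  pointwise n =
    ≤-trans (χ-∨ (bottomColumn i j ∧ (n ≡ᵇ 0)) _)
      (+-mono-≤ (≤-reflexive (χ-∧ (bottomColumn i j) (n ≡ᵇ 0)))
        (≤-trans (χ-∨ (lateColumn i j ∧ (n ≡ᵇ a ∸ 1)) _)
                 (+-monoˡ-≤ (periodic n) (≤-reflexive (χ-∧ (lateColumn i j) (n ≡ᵇ a ∸ 1))))))

∑columns : (Fin 2 → Fin 3 → ℕ) → ℕ
∑columns f = ∑Fin 2 λ i → ∑Fin 3 (f i)

∑columns-+ : (f g : Fin 2 → Fin 3 → ℕ) → ∑columns (λ i j → f i j + g i j) ≡ ∑columns f + ∑columns g
∑columns-+ f g = trans (∑Fin-cong 2 λ i → ∑Fin-+ 3 (f i) (g i)) (∑Fin-+ 2 (λ i → ∑Fin 3 (f i)) (λ i → ∑Fin 3 (g i)))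

size-seeds : (q : ℕ) → size (seeds (q * 6)) ≤ 2 + 10 * q
size-seeds q = begin
  size (seeds a)
    ≡⟨ trans (size≡∑ (seeds a)) (∑-vertices 2 3 a (χ ∘ seeds a)) ⟩
  ∑columns (λ i j → ∑< (χ ∘ seedColumn a i j) a)
    ≤⟨ ∑Fin-mono 2 (λ i → ∑Fin-mono 3 λ j → seedColumn-count q i j) ⟩
  ∑columns (λ i j → χ (bottomColumn i j) + (χ (lateColumn i j) + q * motifCount i j))
    ≡⟨ trans (∑columns-+ (χ ∘₂ bottomColumn) (λ i j → χ (lateColumn i j) + q * motifCount i j))
             (cong (1 +_) (∑columns-+ (χ ∘₂ lateColumn) (λ i j → q * motifCount i j))) ⟩
  2 + ∑columns (λ i j → q * motifCount i j)
    ≡⟨ cong (2 +_) (trans (∑Fin-cong 2 λ i → ∑Fin-*ˡ 3 q (motifCount i)) (∑Fin-*ˡ 2 q (λ i → ∑Fin 3 (motifCount i)))) ⟩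
  2 + q * 10                                                           ≡⟨ cong (2 +_) (*-comm q 10) ⟩
  2 + 10 * q                                                           ∎
  where
  open ≤-Reasoning
  a = q * 6

-- sets of vertices of a window, in window coordinates
motifᵂ bottomᵂ topᵂ nearLayer₀ᵂ layer₀ᵂ layer₁ᵂ nearPeriodᵂ everywhere : {w : ℕ} → VSet 2 3 w
motifᵂ (i , j , x) = motif (toℕ x % 6) (toℕ i) (toℕ j)
bottomᵂ (i , j , x) = bottomColumn i j ∧ (toℕ x ≡ᵇ 0)
topᵂ (i , j , x) = lateColumn i j ∧ (toℕ x ≡ᵇ 5)
nearLayer₀ᵂ (i , j , x) = (toℕ x ≡ᵇ 0) ∧ not (lateColumn i j)
layer₀ᵂ (i , j , x) = toℕ x ≡ᵇ 0
layer₁ᵂ (i , j , x) = toℕ x ≡ᵇ 1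
nearPeriodᵂ (i , j , x) = (toℕ x ≤ᵇ 6) ∧ not (lateColumn i j)
everywhere _ = true

bottom-moves : List (Move 2 3 2)
bottom-moves =
  ((# 0 , # 1 , # 0) , (# 1 , # 1 , # 0) , (# 0 , # 2 , # 0) , (# 0 , # 0 , # 0)) ∷
  ((# 1 , # 0 , # 0) , (# 0 , # 0 , # 0) , (# 1 , # 1 , # 0) , (# 1 , # 0 , # 1)) ∷
  []

period-moves : List (Move 2 3 8)
period-moves =
  ((# 0 , # 0 , # 1) , (# 1 , # 0 , # 1) , (# 0 , # 0 , # 2) , (# 0 , # 0 , # 0)) ∷
  ((# 0 , # 1 , # 2) , (# 0 , # 2 , # 2) , (# 0 , # 0 , # 2) , (# 0 , # 1 , # 3)) ∷
  ((# 1 , # 0 , # 2) , (# 0 , # 0 , # 2) , (# 1 , # 0 , # 3) , (# 1 , # 0 , # 1)) ∷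
  ((# 0 , # 0 , # 3) , (# 1 , # 0 , # 3) , (# 0 , # 1 , # 3) , (# 0 , # 0 , # 2)) ∷
  ((# 0 , # 2 , # 3) , (# 0 , # 1 , # 3) , (# 0 , # 2 , # 4) , (# 0 , # 2 , # 2)) ∷
  ((# 0 , # 1 , # 4) , (# 0 , # 2 , # 4) , (# 0 , # 1 , # 5) , (# 0 , # 1 , # 3)) ∷
  ((# 0 , # 0 , # 5) , (# 1 , # 0 , # 5) , (# 0 , # 1 , # 5) , (# 0 , # 0 , # 6)) ∷
  ((# 0 , # 2 , # 5) , (# 0 , # 1 , # 5) , (# 0 , # 2 , # 6) , (# 0 , # 2 , # 4)) ∷
  ((# 0 , # 1 , # 6) , (# 0 , # 2 , # 6) , (# 0 , # 0 , # 6) , (# 0 , # 1 , # 5)) ∷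
  ((# 1 , # 0 , # 6) , (# 0 , # 0 , # 6) , (# 1 , # 0 , # 7) , (# 1 , # 0 , # 5)) ∷
  ((# 0 , # 1 , # 1) , (# 0 , # 0 , # 1) , (# 0 , # 1 , # 2) , (# 0 , # 1 , # 0)) ∷
  ((# 0 , # 2 , # 1) , (# 0 , # 1 , # 1) , (# 0 , # 2 , # 2) , (# 0 , # 2 , # 0)) ∷
  ((# 1 , # 1 , # 1) , (# 0 , # 1 , # 1) , (# 1 , # 0 , # 1) , (# 1 , # 1 , # 0)) ∷
  ((# 1 , # 1 , # 2) , (# 0 , # 1 , # 2) , (# 1 , # 0 , # 2) , (# 1 , # 1 , # 1)) ∷
  ((# 1 , # 1 , # 3) , (# 0 , # 1 , # 3) , (# 1 , # 0 , # 3) , (# 1 , # 1 , # 2)) ∷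
  ((# 0 , # 0 , # 4) , (# 0 , # 1 , # 4) , (# 0 , # 0 , # 5) , (# 0 , # 0 , # 3)) ∷
  ((# 1 , # 0 , # 4) , (# 0 , # 0 , # 4) , (# 1 , # 0 , # 5) , (# 1 , # 0 , # 3)) ∷
  ((# 1 , # 1 , # 4) , (# 0 , # 1 , # 4) , (# 1 , # 0 , # 4) , (# 1 , # 1 , # 3)) ∷
  ((# 1 , # 1 , # 5) , (# 0 , # 1 , # 5) , (# 1 , # 0 , # 5) , (# 1 , # 1 , # 4)) ∷
  ((# 1 , # 1 , # 6) , (# 0 , # 1 , # 6) , (# 1 , # 0 , # 6) , (# 1 , # 1 , # 5)) ∷
  []

top-moves : List (Move 2 3 6)
top-moves =
  ((# 0 , # 0 , # 1) , (# 1 , # 0 , # 1) , (# 0 , # 0 , # 2) , (# 0 , # 0 , # 0)) ∷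
  ((# 0 , # 1 , # 2) , (# 0 , # 2 , # 2) , (# 0 , # 0 , # 2) , (# 0 , # 1 , # 3)) ∷
  ((# 1 , # 0 , # 2) , (# 0 , # 0 , # 2) , (# 1 , # 0 , # 3) , (# 1 , # 0 , # 1)) ∷
  ((# 0 , # 0 , # 3) , (# 1 , # 0 , # 3) , (# 0 , # 1 , # 3) , (# 0 , # 0 , # 2)) ∷
  ((# 0 , # 2 , # 3) , (# 0 , # 1 , # 3) , (# 0 , # 2 , # 4) , (# 0 , # 2 , # 2)) ∷
  ((# 0 , # 1 , # 4) , (# 0 , # 2 , # 4) , (# 0 , # 1 , # 5) , (# 0 , # 1 , # 3)) ∷
  ((# 0 , # 2 , # 5) , (# 1 , # 2 , # 5) , (# 0 , # 1 , # 5) , (# 0 , # 2 , # 4)) ∷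
  ((# 1 , # 1 , # 5) , (# 0 , # 1 , # 5) , (# 1 , # 2 , # 5) , (# 1 , # 0 , # 5)) ∷
  ((# 0 , # 1 , # 1) , (# 0 , # 0 , # 1) , (# 0 , # 1 , # 2) , (# 0 , # 1 , # 0)) ∷
  ((# 0 , # 2 , # 1) , (# 0 , # 1 , # 1) , (# 0 , # 2 , # 2) , (# 0 , # 2 , # 0)) ∷
  ((# 1 , # 1 , # 1) , (# 0 , # 1 , # 1) , (# 1 , # 0 , # 1) , (# 1 , # 1 , # 0)) ∷
  ((# 1 , # 1 , # 2) , (# 0 , # 1 , # 2) , (# 1 , # 0 , # 2) , (# 1 , # 1 , # 1)) ∷
  ((# 1 , # 1 , # 3) , (# 0 , # 1 , # 3) , (# 1 , # 0 , # 3) , (# 1 , # 1 , # 2)) ∷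
  ((# 1 , # 1 , # 4) , (# 0 , # 1 , # 4) , (# 1 , # 1 , # 5) , (# 1 , # 1 , # 3)) ∷
  ((# 1 , # 2 , # 4) , (# 0 , # 2 , # 4) , (# 1 , # 1 , # 4) , (# 1 , # 2 , # 5)) ∷
  ((# 1 , # 2 , # 3) , (# 0 , # 2 , # 3) , (# 1 , # 1 , # 3) , (# 1 , # 2 , # 4)) ∷
  ((# 1 , # 0 , # 4) , (# 1 , # 1 , # 4) , (# 1 , # 0 , # 5) , (# 1 , # 0 , # 3)) ∷
  ((# 1 , # 2 , # 2) , (# 0 , # 2 , # 2) , (# 1 , # 1 , # 2) , (# 1 , # 2 , # 3)) ∷
  ((# 0 , # 0 , # 4) , (# 1 , # 0 , # 4) , (# 0 , # 1 , # 4) , (# 0 , # 0 , # 3)) ∷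
  ((# 0 , # 0 , # 5) , (# 1 , # 0 , # 5) , (# 0 , # 1 , # 5) , (# 0 , # 0 , # 4)) ∷
  ((# 1 , # 2 , # 1) , (# 0 , # 2 , # 1) , (# 1 , # 1 , # 1) , (# 1 , # 2 , # 2)) ∷
  ((# 1 , # 2 , # 0) , (# 0 , # 2 , # 0) , (# 1 , # 1 , # 0) , (# 1 , # 2 , # 1)) ∷
  []

late-moves : List (Move 2 3 2)
late-moves = ((# 1 , # 2 , # 0) , (# 0 , # 2 , # 0) , (# 1 , # 1 , # 0) , (# 1 , # 2 , # 1)) ∷ []

bottom-certificate : Certifies (motifᵂ ∪ bottomᵂ) bottom-moves nearLayer₀ᵂ
bottom-certificate = _

period-certificate : Certifies (motifᵂ ∪ nearLayer₀ᵂ) period-moves nearPeriodᵂ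
period-certificate = _

top-certificate : Certifies (motifᵂ ∪ (nearLayer₀ᵂ ∪ topᵂ)) top-moves everywhere
top-certificate = _

late-certificate : Certifies (nearLayer₀ᵂ ∪ layer₁ᵂ) late-moves layer₀ᵂ
late-certificate = _

module Percolation (p : ℕ) where
  a : ℕ
  a = suc p * 6

  A : VSet 2 3 a
  A = seeds a

  NearlyFull Full : ℕ → Set
  NearlyFull n = ∀ i j (k : Fin a) → toℕ k ≡ n → T (not (lateColumn i j)) → Eventually A (i , j , k)
  Full n = ∀ i j (k : Fin a) → toℕ k ≡ n → Eventually A (i , j , k)

  seed-bottom : ∀ i j (k : Fin a) → T (bottomColumn i j) → toℕ k ≡ 0 → Eventually A (i , j , k)
  seed-bottom i j k column k≡0 = 0 , T⇒≡true (∨-introˡ _ (∧-intro column (≡⇒≡ᵇ _ _ k≡0)))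

  seed-top : ∀ i j (k : Fin a) → T (lateColumn i j) → toℕ k ≡ a ∸ 1 → Eventually A (i , j , k)
  seed-top i j k column k≡a-1 =
    0 , T⇒≡true (∨-introʳ (bottomColumn i j ∧ _) (∨-introˡ _ (∧-intro column (≡⇒≡ᵇ _ _ k≡a-1))))

  seed-motif : ∀ i j (k : Fin a) → T (motif (toℕ k % 6) (toℕ i) (toℕ j)) → Eventually A (i , j , k)
  seed-motif i j k k∈ = 0 , T⇒≡true (∨-introʳ (bottomColumn i j ∧ _) (∨-introʳ (lateColumn i j ∧ _) k∈))

  module _ {o w : ℕ} (o+w≤a : o + w ≤ a) where
    open Window A o w o+w≤a

    known-motif : ∀ c → o ≡ c * 6 → Known motifᵂ
    known-motif c refl (i , j , x) x∈ =
      seed-motif i j (shift x) (subst (λ r → T (motif r (toℕ i) (toℕ j))) (sym same-residue) x∈)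
      where
      same-residue : toℕ (shift x) % 6 ≡ toℕ x % 6
      same-residue = trans (cong (_% 6) (trans (toℕ-shift x) (+-comm (c * 6) (toℕ x)))) ([m+kn]%n≡m%n (toℕ x) c 6)

    known-bottom : o ≡ 0 → Known bottomᵂ
    known-bottom refl (i , j , x) x∈ with ∧-elim {bottomColumn i j} x∈
    ... | column , x≡0 = seed-bottom i j (shift x) column (trans (toℕ-shift x) (≡ᵇ⇒≡ _ _ x≡0))

    known-top : o + 6 ≡ a → Known topᵂ
    known-top o+6≡a (i , j , x) x∈ with ∧-elim {lateColumn i j} x∈
    ... | column , x≡5 = seed-top i j (shift x) column (begin
      toℕ (shift x)  ≡⟨ toℕ-shift x ⟩
      o + toℕ x      ≡⟨ cong (o +_) (≡ᵇ⇒≡ _ _ x≡5) ⟩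
      o + 5          ≡⟨ +-∸-assoc o (s≤s z≤n) ⟨
      o + 6 ∸ 1      ≡⟨ cong (_∸ 1) o+6≡a ⟩
      a ∸ 1          ∎)
      where open ≡-Reasoning

    known-nearLayer₀ : NearlyFull o → Known nearLayer₀ᵂ
    known-nearLayer₀ nearlyFull (i , j , x) x∈ with ∧-elim {toℕ x ≡ᵇ 0} x∈
    ... | x≡0 , outside =
      nearlyFull i j (shift x) (trans (toℕ-shift x) (trans (cong (o +_) (≡ᵇ⇒≡ _ _ x≡0)) (+-identityʳ o))) outside

    known-layer₁ : Full (o + 1) → Known layer₁ᵂ
    known-layer₁ full (i , j , x) x≡1 = full i j (shift x) (trans (toℕ-shift x) (cong (o +_) (≡ᵇ⇒≡ _ _ x≡1)))

  nearlyFull-bottom : NearlyFull 0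
  nearlyFull-bottom i j k k≡0 outside = eventually-layer known i j k z<s k≡0 outside
    where
    fits : 0 + 2 ≤ a
    fits = s≤s (s≤s z≤n)
    open Window A 0 2 fits
    known : Known nearLayer₀ᵂ
    known = certified bottom-moves bottom-certificate (known-∪ (known-motif fits 0 refl) (known-bottom fits refl))

  nearlyFull-period : ∀ c → c * 6 + 8 ≤ a → NearlyFull (c * 6) → ∀ r → r ≤ 6 → NearlyFull (c * 6 + r)
  nearlyFull-period c fits nearlyFull r r≤6 i j k k≡c*6+r outside =
    eventually-layer known i j k r<8 k≡c*6+r (∧-intro (≤⇒≤ᵇ (≤-trans (≤-reflexive (toℕ-fromℕ< r<8)) r≤6)) outside)
    where
    open Window A (c * 6) 8 fits
    r<8 : r < 8
    r<8 = s≤s (m≤n⇒m≤1+n r≤6)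
    known : Known nearPeriodᵂ
    known = certified period-moves period-certificate (known-∪ (known-motif fits c refl) (known-nearLayer₀ fits nearlyFull))

  nearlyFull-upTo : ∀ c → c ≤ p → ∀ n → n ≤ c * 6 → NearlyFull n
  nearlyFull-upTo zero _ n n≤0 = subst NearlyFull (sym (n≤0⇒n≡0 n≤0)) nearlyFull-bottom
  nearlyFull-upTo (suc c) c<p n n≤6+c*6 with n ≤? c * 6
  ... | yes n≤c*6 = nearlyFull-upTo c (<⇒≤ c<p) n n≤c*6
  ... | no n≰c*6 = subst NearlyFull (m+[n∸m]≡n c*6≤n)
        (nearlyFull-period c fits (nearlyFull-upTo c (<⇒≤ c<p) (c * 6) ≤-refl) (n ∸ c * 6) n∸c*6≤6)
    where
    c*6≤n : c * 6 ≤ n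
    c*6≤n = <⇒≤ (≰⇒> n≰c*6)
    n∸c*6≤6 : n ∸ c * 6 ≤ 6
    n∸c*6≤6 = ≤-trans (∸-monoˡ-≤ (c * 6) n≤6+c*6) (≤-reflexive (m+n∸n≡m 6 (c * 6)))
    fits : c * 6 + 8 ≤ a
    fits = begin
      c * 6 + 8     ≤⟨ +-monoʳ-≤ (c * 6) (m≤m+n 8 4) ⟩
      c * 6 + 12    ≡⟨ +-comm (c * 6) 12 ⟩
      6 + suc c * 6 ≤⟨ +-monoʳ-≤ 6 (*-monoˡ-≤ 6 c<p) ⟩
      a             ∎
      where open ≤-Reasoning

  full-top : ∀ r → r < 6 → Full (p * 6 + r)
  full-top r r<6 i j k k≡p*6+r = eventually-layer known i j k r<6 k≡p*6+r _
    where
    p*6+6≡a : p * 6 + 6 ≡ a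
    p*6+6≡a = +-comm (p * 6) 6
    fits : p * 6 + 6 ≤ a
    fits = ≤-reflexive p*6+6≡a
    open Window A (p * 6) 6 fits
    known : Known everywhere
    known = certified top-moves top-certificate
      (known-∪ (known-motif fits p refl)
               (known-∪ (known-nearLayer₀ fits (nearlyFull-upTo p ≤-refl (p * 6) ≤-refl)) (known-top fits p*6+6≡a)))

  full-below : ∀ d n → n + d ≡ p * 6 → Full n
  full-below zero n n≡p*6 i j k k≡n =
    full-top 0 z<s i j k (trans k≡n (trans (sym (+-identityʳ n)) (trans n≡p*6 (sym (+-identityʳ (p * 6))))))
  full-below (suc d) n n+1+d≡p*6 i j k k≡n = eventually-layer known i j k z<s (trans k≡n (sym (+-identityʳ n))) _
    where
    n<p*6 : n < p * 6
    n<p*6 = subst (n <_) n+1+d≡p*6 (m<m+n n z<s)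
    fits : n + 2 ≤ a
    fits = ≤-trans (≤-reflexive (+-comm n 2)) (s≤s (≤-trans n<p*6 (m≤n+m (p * 6) 5)))
    open Window A n 2 fits
    known : Known layer₀ᵂ
    known = certified late-moves late-certificate
      (known-∪ (known-nearLayer₀ fits (nearlyFull-upTo p ≤-refl n (<⇒≤ n<p*6)))
               (known-layer₁ fits (full-below d (n + 1) (trans (+-assoc n 1 d) n+1+d≡p*6))))

  percolates : Percolates A
  percolates (i , j , k) with toℕ k ≤? p * 6
  ... | yes k≤p*6 = full-below (p * 6 ∸ toℕ k) (toℕ k) (m+[n∸m]≡n k≤p*6) i j k refl
  ... | no k≰p*6 = full-top (toℕ k ∸ p * 6) k∸p*6<6 i j k (sym (m+[n∸m]≡n (<⇒≤ (≰⇒> k≰p*6))))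
    where
    k∸p*6<6 : toℕ k ∸ p * 6 < 6
    k∸p*6<6 = m<n+o⇒m∸n<o (toℕ k) (p * 6) (≤-trans (Fin.toℕ<n k) (≤-reflexive (+-comm 6 (p * 6))))

perfect-2×3×6q : (p : ℕ) → Perfect 2 3 (suc p * 6)
perfect-2×3×6q p =
  σ%3≡0 , (seeds a , percolates , ≤-antisym size≤σ/3 (σ/3≤size (seeds a) percolates)) , σ/3≤size
  where
  open Percolation p using (a; percolates)
  σ≡ : σ 2 3 a ≡ (2 + 10 * suc p) * 3
  σ≡ = identity p
    where
    identity : ∀ p → 2 * 3 + 2 * (suc p * 6) + 3 * (suc p * 6) ≡ (2 + 10 * suc p) * 3
    identity = solve-∀
  σ%3≡0 : σ 2 3 a % 3 ≡ 0
  σ%3≡0 = trans (cong (_% 3) σ≡) (m*n%n≡0 (2 + 10 * suc p) 3)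
  size≤σ/3 : size (seeds a) ≤ σ 2 3 a / 3
  size≤σ/3 = ≤-trans (size-seeds (suc p)) (≤-reflexive (sym (trans (cong (_/ 3) σ≡) (m*n/n≡m (2 + 10 * suc p) 3))))

proposition5p3 : (a₃ : ℕ) → 6 ≤ a₃ → a₃ % 6 ≡ 0 → Perfect 2 3 a₃
proposition5p3 a₃ 6≤a₃ a₃%6≡0 with a₃ / 6 | m≡m%n+[m/n]*n a₃ 6
... | zero | a₃≡0 = contradiction (trans a₃≡0 (cong (_+ 0) a₃%6≡0)) (m<n⇒n≢0 6≤a₃)
... | suc p | a₃≡p*6 = subst (Perfect 2 3) (sym (trans a₃≡p*6 (cong (_+ suc p * 6) a₃%6≡0))) (perfect-2×3×6q p)
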